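{- Let $n\ge 3$ and $S\subseteq[n]$ with $CP_n(S)\neq\emptyset$. If $|S|<\lfloor\frac{n-1}{2}\rfloor$, then $CP_{n+1}(S\cup\{n+1\})\neq\emptyset$. If $|S|=\lfloor\frac{n-1}{2}\rfloor$, then $CP_{n+1}(S\cup\{n+1\})\neq\emptyset$ when $n$ is even, and $CP_{n+1}(S\cup\{n+1\})=\emptyset$ when $n$ is odd.
   Context: $[n]=\{1,\dots,n\}$ and $\mathfrak S_n$ is the set of permutations of $[n]$, written in one-line notation $\sigma=\sigma(1)\cdots\sigma(n)$. The circular peak set of $\sigma$ is $CP(\sigma)=\{\sigma(i)\mid 2\le i\le n-1,\ \sigma(i-1)<\sigma(i)>\sigma(i+1)\}$. For $S\subseteq[n]$, $CP_n(S)=\{\sigma\in\mathfrak S_n\mid CP(\sigma)=S\}$. -}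

module Defs where

open import Data.Nat using (ℕ; suc)
open import Data.Fin using (Fin; toℕ; _<_)
open import Data.Fin.Subset using (Subset; _∈_)
open import Data.Fin.Permutation using (Permutation′; _⟨$⟩ʳ_)
open import Data.Product using (Σ; _×_; ∃)
open import Function.Bundles using (_⇔_)
open import Relation.Binary.PropositionalEquality using (_≡_)

-- Values and positions in [n] = {1,…,n} are encoded by Fin n (i ↦ toℕ i + 1).
-- This shift preserves order, so peaks are unaffected.

IsCPeak : {n : ℕ} → Permutation′ n → Fin n → Set
IsCPeak {n} σ v =
  Σ (Fin n) λ i → Σ (Fin n) λ j → Σ (Fin n) λ k →
    (toℕ j ≡ suc (toℕ i)) × (toℕ k ≡ suc (toℕ j)) ×
    (σ ⟨$⟩ʳ j ≡ v) × (σ ⟨$⟩ʳ i < σ ⟨$⟩ʳ j) × (σ ⟨$⟩ʳ k < σ ⟨$⟩ʳ j)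

HasCPSet : {n : ℕ} → Permutation′ n → Subset n → Set
HasCPSet {n} σ S = (v : Fin n) → (v ∈ S ⇔ IsCPeak σ v)

CPNonEmpty : (n : ℕ) → Subset n → Set
CPNonEmpty n S = ∃ λ (σ : Permutation′ n) → HasCPSet σ S

-- A peak is never at either end and never next to another peak, so a
-- sequence of length m has at most ⌊(m−1)/2⌋ peaks: 2·|CP(σ)| < m.
-- Conversely, if 2·|CP(σ)| + 2 ≤ m then two adjacent positions h, h+1 are
-- both non-peaks, for otherwise the non-peaks, being pairwise non-adjacent,
-- would number at most (m+1)/2.  Inserting the new maximum between them makes it a peak;
-- only its two neighbours can change status, and they were not peaks, so the
-- peak set grows by exactly the maximum.  For |S| < ⌊(n−1)/2⌋, or
-- |S| = ⌊(n−1)/2⌋ with n even, such a gap exists; for n odd and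
-- |S| = (n−1)/2 the bound 2·|S ∪ {n+1}| < n+1 fails.
module Submission where

open import Defs
open import Data.Bool.Base using (if_then_else_)
open import Data.Fin.Base as Fin using (Fin; toℕ; fromℕ; fromℕ<; punchIn; punchOut)
open import Data.Fin.Permutation using (Permutation; Permutation′; _⟨$⟩ʳ_; _⟨$⟩ˡ_; inverseˡ; inverseʳ; insert; insert-punchIn)
open import Data.Fin.Properties using (_≟_; toℕ<n; toℕ-fromℕ; toℕ-fromℕ<; fromℕ<-toℕ; punchIn-punchOut)
open import Data.Fin.Subset using (Subset; ∣_∣; inside; outside; _∈_)
open import Data.Fin.Subset.Properties using (_∈?_)
open import Data.Nat.Base using (ℕ; zero; suc; pred; _+_; _*_; _∸_; _/_; _%_; _≤_; _<_; z≤n; s≤s; z<s; s≤s⁻¹; s<s⁻¹; >-nonZero)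
open import Data.Nat.DivMod using (m%n<n; m≡m%n+[m/n]*n; m/n*n≤m; [m+kn]%n≡m%n)
open import Data.Nat.Properties
  using (_<?_; _≤?_; anyUpTo?; +-0-commutativeMonoid; module ≤-Reasoning
        ; ≤-refl; ≤-reflexive; ≤-trans; <-trans; <-irrefl; <-asym; ≤-<-trans; <-≤-trans
        ; n<1+n; m<n⇒m<1+n; m≤n⇒m≤1+n; m≤n⇒m<n∨m≡n; <⇒≱; ≮⇒≥; ≰⇒>; pred[n]≤n; suc-pred
        ; +-comm; +-suc; +-identityʳ; *-comm; *-suc; *-distribˡ-+
        ; +-mono-≤; +-monoˡ-≤; +-monoʳ-≤; *-monoʳ-≤; +-cancelʳ-≤)
open import Data.Product.Base using (∃; _×_; _,_)
open import Data.Sum.Base using (_⊎_; inj₁; inj₂)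
open import Data.Vec.Base using ([]; _∷_; _∷ʳ_; here; there)
open import Function.Base using (_∘_)
open import Function.Bundles using (_⇔_; mk⇔; Equivalence)
open import Function.Construct.Composition using (_⇔-∘_)
open import Function.Construct.Symmetry using (⇔-sym)
open import Function.Properties.Equivalence using (⇔-setoid)
open import Level using (0ℓ)
open import Relation.Binary.PropositionalEquality
  using (_≡_; refl; sym; trans; cong; cong₂; subst; subst₂; module ≡-Reasoning)
import Relation.Binary.Reasoning.Setoid as SetoidReasoning
open import Relation.Nullary.Decidable using (Dec; yes; no; does; ¬?; _×-dec_; map′; does-⇔)
open import Relation.Nullary.Negation using (¬_; contradiction)
open import Relation.Unary using (Decidable)
open import Algebra.Properties.CommutativeMonoid.Sum +-0-commutativeMonoid
  using (sum-syntax; sum-permute; sum-cong-≗)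

indicator : {A : Set} → Dec A → ℕ
indicator a? = if does a? then 1 else 0

indicator≤1 : {A : Set} (a? : Dec A) → indicator a? ≤ 1
indicator≤1 (yes _) = s≤s z≤n
indicator≤1 (no _)  = z≤n

indicator-no : {A : Set} → ¬ A → (a? : Dec A) → indicator a? ≡ 0
indicator-no ¬a (yes a) = contradiction a ¬a
indicator-no ¬a (no _)  = refl

indicator-⇔ : {A B : Set} → A ⇔ B → (a? : Dec A) (b? : Dec B) → indicator a? ≡ indicator b?
indicator-⇔ A⇔B a? b? = cong (if_then 1 else 0) (does-⇔ A⇔B a? b?)

count : {P : ℕ → Set} → Decidable P → ℕ → ℕ
count P? m = ∑[ x < m ] indicator (P? (toℕ x))

count+count-¬ : {P : ℕ → Set} (P? : Decidable P) (m : ℕ) → count P? m + count (¬? ∘ P?) m ≡ m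
count+count-¬ P? zero = refl
count+count-¬ P? (suc m) with P? 0
... | yes _ = cong suc (count+count-¬ (P? ∘ suc) m)
... | no _  = trans (+-suc _ _) (cong suc (count+count-¬ (P? ∘ suc) m))

count-sparse : {P : ℕ → Set} (P? : Decidable P) (y : ℕ) → (∀ {x} → x < y → P x → ¬ P (suc x)) →
  2 * count P? (suc y) ≤ indicator (P? 0) + y + indicator (P? y)
count-sparse P? zero _ with P? 0
... | yes _ = ≤-refl
... | no _  = z≤n
count-sparse P? (suc y) sparse with P? 0
... | yes p₀ = begin
  2 * (1 + c)                                          ≡⟨ *-distribˡ-+ 2 1 c ⟩
  2 + 2 * c                                            ≤⟨ +-monoʳ-≤ 2 (count-sparse (P? ∘ suc) y (sparse ∘ s≤s)) ⟩
  2 + (indicator (P? 1) + y + indicator (P? (suc y)))  ≡⟨ cong (λ i → 2 + (i + y + indicator (P? (suc y))))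
                                                              (indicator-no (sparse z<s p₀) (P? 1)) ⟩
  2 + (y + indicator (P? (suc y)))                     ∎
  where
  open ≤-Reasoning
  c = count (P? ∘ suc) (suc y)
... | no _ = ≤-trans (count-sparse (P? ∘ suc) y (sparse ∘ s≤s))
                   (+-monoˡ-≤ _ (+-monoˡ-≤ y (indicator≤1 (P? 1))))

2*d≤1+m⇒m<2*[1+c] : ∀ {c d m} → c + d ≡ m → 2 * d ≤ suc m → m < 2 * suc c
2*d≤1+m⇒m<2*[1+c] {c} {d} {m} c+d≡m 2d≤1+m =
  subst (m <_) (sym (*-suc 2 c)) (s≤s (+-cancelʳ-≤ m m (suc (2 * c)) (begin
    m + m            ≡⟨ cong (m +_) (sym (+-identityʳ m)) ⟩
    2 * m            ≡⟨ cong (2 *_) (sym c+d≡m) ⟩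
    2 * (c + d)      ≡⟨ *-distribˡ-+ 2 c d ⟩
    2 * c + 2 * d    ≤⟨ +-monoʳ-≤ (2 * c) 2d≤1+m ⟩
    2 * c + suc m    ≡⟨ +-suc (2 * c) m ⟩
    suc (2 * c) + m  ∎)))
  where open ≤-Reasoning

Peak : ℕ → (ℕ → ℕ) → ℕ → Set
Peak m a x = 0 < x × suc x < m × a (pred x) < a x × a (suc x) < a x

peak? : ∀ m a → Decidable (Peak m a)
peak? m a x = 0 <? x ×-dec suc x <? m ×-dec a (pred x) <? a x ×-dec a (suc x) <? a x

peak⇒¬peak-suc : ∀ {m a x} → Peak m a x → ¬ Peak m a (suc x)
peak⇒¬peak-suc (_ , _ , _ , fall) (_ , _ , rise , _) = <-asym fall rise

peakCount : ℕ → (ℕ → ℕ) → ℕ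
peakCount m a = count (peak? m a) m

peakCount-bound : ∀ y a → 2 * peakCount (suc y) a < suc y
peakCount-bound y a = s≤s (begin
  2 * peakCount (suc y) a                          ≤⟨ count-sparse peak?′ y (λ _ → peak⇒¬peak-suc {a = a}) ⟩
  indicator (peak?′ 0) + y + indicator (peak?′ y)  ≡⟨ cong₂ (λ i j → i + y + j)
                                                         (indicator-no ¬peak-first (peak?′ 0))
                                                         (indicator-no ¬peak-last (peak?′ y)) ⟩
  y + 0                                            ≡⟨ +-identityʳ y ⟩
  y                                                ∎)
  where
  open ≤-Reasoning
  peak?′ = peak? (suc y) a
  ¬peak-first : ¬ Peak (suc y) a 0
  ¬peak-first (() , _)
  ¬peak-last : ¬ Peak (suc y) a y
  ¬peak-last (_ , y+1<y+1 , _) = <-irrefl refl y+1<y+1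

Gap : ℕ → (ℕ → ℕ) → Set
Gap m a = ∃ λ h → suc h < m × ¬ Peak m a h × ¬ Peak m a (suc h)

gap? : ∀ m a → Dec (Gap m a)
gap? m a = map′ (λ (h , _ , gap) → h , gap)
                (λ (h , gap@(h+1<m , _)) → h , <-trans (n<1+n h) h+1<m , gap)
                (anyUpTo? (λ h → suc h <? m ×-dec ¬? (peak? m a h) ×-dec ¬? (peak? m a (suc h))) m)

¬gap⇒m<2*[1+peakCount] : ∀ m a → ¬ Gap m a → m < 2 * suc (peakCount m a)
¬gap⇒m<2*[1+peakCount] zero a _ = z<s
¬gap⇒m<2*[1+peakCount] m@(suc y) a ¬gap = 2*d≤1+m⇒m<2*[1+c] (count+count-¬ (peak? m a) m) (begin
  2 * count ¬peak? m                               ≤⟨ count-sparse ¬peak? y non-peaks-apart ⟩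
  indicator (¬peak? 0) + y + indicator (¬peak? y)  ≤⟨ +-mono-≤ (+-monoˡ-≤ y (indicator≤1 (¬peak? 0)))
                                                               (indicator≤1 (¬peak? y)) ⟩
  suc y + 1                                        ≡⟨ +-comm (suc y) 1 ⟩
  suc m                                            ∎)
  where
  open ≤-Reasoning
  ¬peak? = ¬? ∘ peak? m a
  non-peaks-apart : ∀ {x} → x < y → ¬ Peak m a x → ¬ ¬ Peak m a (suc x)
  non-peaks-apart x<y ¬peak-x ¬peak-x+1 = ¬gap (_ , s≤s x<y , ¬peak-x , ¬peak-x+1)

2*[1+peakCount]≤m⇒gap : ∀ m a → 2 * suc (peakCount m a) ≤ m → Gap m a
2*[1+peakCount]≤m⇒gap m a few-peaks with gap? m a
... | yes gap = gap
... | no ¬gap = contradiction few-peaks (<⇒≱ (¬gap⇒m<2*[1+peakCount] m a ¬gap))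

record IsInsertion (g v : ℕ) (a b : ℕ → ℕ) : Set where
  field
    below    : ∀ {x} → x < g → b x ≡ a x
    inserted : b g ≡ v
    above    : ∀ {x} → g ≤ x → b (suc x) ≡ a x

module InsertMaximum {n g a b} (ins : IsInsertion g n a b) (a<n : ∀ {x} → x < n → a x < n) (g<n : g < n) where

  open IsInsertion ins

  peak-inserted : 0 < g → Peak (suc n) b g
  peak-inserted 0<g@(s≤s _) = 0<g , s≤s g<n ,
    subst₂ _<_ (sym (below (n<1+n _))) (sym inserted) (a<n (<-trans (n<1+n _) g<n)) ,
    subst₂ _<_ (sym (above ≤-refl)) (sym inserted) (a<n g<n)

  peak-below⇔ : ∀ {j} → ¬ Peak n a (pred g) → j < g → Peak (suc n) b j ⇔ Peak n a j
  peak-below⇔ {j} ¬peak-g-1 j<g = mk⇔ to from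
    where
    j-1<g = ≤-<-trans pred[n]≤n j<g
    to : Peak (suc n) b j → Peak n a j
    to (0<j , _ , rise , fall) with m≤n⇒m<n∨m≡n j<g
    ... | inj₁ j+1<g = 0<j , <-trans j+1<g g<n ,
      subst₂ _<_ (below j-1<g) (below j<g) rise , subst₂ _<_ (below j+1<g) (below j<g) fall
    ... | inj₂ refl = contradiction (subst₂ _<_ inserted (below j<g) fall) (<-asym (a<n (<-trans j<g g<n)))
    from : Peak n a j → Peak (suc n) b j
    from peak@(0<j , j+1<n , rise , fall) with m≤n⇒m<n∨m≡n j<g
    ... | inj₁ j+1<g = 0<j , m<n⇒m<1+n j+1<n ,
      subst₂ _<_ (sym (below j-1<g)) (sym (below j<g)) rise , subst₂ _<_ (sym (below j+1<g)) (sym (below j<g)) fall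
    ... | inj₂ refl = contradiction peak ¬peak-g-1

  peak-above⇔ : ∀ {j} → ¬ Peak n a g → g ≤ j → Peak (suc n) b (suc j) ⇔ Peak n a j
  peak-above⇔ {j} ¬peak-g g≤j = mk⇔ to from
    where
    to : Peak (suc n) b (suc j) → Peak n a j
    to (_ , j+2<n+1 , rise , fall) with m≤n⇒m<n∨m≡n g≤j
    ... | inj₁ (s≤s g≤j-1) = z<s , s<s⁻¹ j+2<n+1 ,
      subst₂ _<_ (above g≤j-1) (above g≤j) rise , subst₂ _<_ (above (m≤n⇒m≤1+n g≤j)) (above g≤j) fall
    ... | inj₂ refl = contradiction (subst₂ _<_ inserted (above g≤j) rise) (<-asym (a<n g<n))
    from : Peak n a j → Peak (suc n) b (suc j)
    from peak@(_ , j+1<n , rise , fall) with m≤n⇒m<n∨m≡n g≤j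
    ... | inj₁ (s≤s g≤j-1) = z<s , s≤s j+1<n ,
      subst₂ _<_ (sym (above g≤j-1)) (sym (above g≤j)) rise ,
      subst₂ _<_ (sym (above (m≤n⇒m≤1+n g≤j))) (sym (above g≤j)) fall
    ... | inj₂ refl = contradiction peak ¬peak-g

-- σ as a sequence: position x ↦ value σ(x), both 0-based as in Defs; 0 outside [0, m).
at : ∀ {m} → Permutation′ m → ℕ → ℕ
at {m} σ x with x <? m
... | yes x<m = toℕ (σ ⟨$⟩ʳ fromℕ< x<m)
... | no _    = 0

at-fromℕ< : ∀ {m x} (σ : Permutation′ m) (x<m : x < m) → at σ x ≡ toℕ (σ ⟨$⟩ʳ fromℕ< x<m)
at-fromℕ< {m} {x} σ x<m with x <? m
... | yes _   = refl
... | no x≮m = contradiction x<m x≮m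

at-toℕ : ∀ {m} (σ : Permutation′ m) (j : Fin m) → at σ (toℕ j) ≡ toℕ (σ ⟨$⟩ʳ j)
at-toℕ σ j = trans (at-fromℕ< σ (toℕ<n j)) (cong (λ k → toℕ (σ ⟨$⟩ʳ k)) (fromℕ<-toℕ j (toℕ<n j)))

at-≥ : ∀ {m x} (σ : Permutation′ m) → m ≤ x → at σ x ≡ 0
at-≥ {m} {x} σ m≤x with x <? m
... | yes x<m = contradiction m≤x (<⇒≱ x<m)
... | no _    = refl

at<m : ∀ {m} (σ : Permutation′ m) {x} → x < m → at σ x < m
at<m σ x<m = subst (_< _) (sym (at-fromℕ< σ x<m)) (toℕ<n _)

isCPeak⇔peak : ∀ {m} (σ : Permutation′ m) (j : Fin m) → IsCPeak σ (σ ⟨$⟩ʳ j) ⇔ Peak m (at σ) (toℕ j)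
isCPeak⇔peak {m} σ j = mk⇔ to from
  where
  to : IsCPeak σ (σ ⟨$⟩ʳ j) → Peak m (at σ) (toℕ j)
  to (i , j′ , k , j′≡1+i , k≡1+j′ , σj′≡σj , rise , fall)
    with trans (sym (inverseˡ σ)) (trans (cong (σ ⟨$⟩ˡ_) σj′≡σj) (inverseˡ σ))
  ... | refl = subst (0 <_) (sym j′≡1+i) z<s , subst (_< m) k≡1+j′ (toℕ<n k) ,
    subst₂ _<_ (trans (sym (at-toℕ σ i)) (cong (at σ ∘ pred) (sym j′≡1+i))) (sym (at-toℕ σ j)) rise ,
    subst₂ _<_ (trans (sym (at-toℕ σ k)) (cong (at σ) k≡1+j′)) (sym (at-toℕ σ j)) fall
  from : Peak m (at σ) (toℕ j) → IsCPeak σ (σ ⟨$⟩ʳ j)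
  from (0<j , j+1<m , rise , fall) = i , j , k , j≡1+i , toℕ-fromℕ< j+1<m , refl ,
    subst₂ _<_ (at-fromℕ< σ j-1<m) (at-toℕ σ j) rise ,
    subst₂ _<_ (at-fromℕ< σ j+1<m) (at-toℕ σ j) fall
    where
    j-1<m = ≤-<-trans pred[n]≤n (toℕ<n j)
    i = fromℕ< j-1<m
    k = fromℕ< j+1<m
    j≡1+i : toℕ j ≡ suc (toℕ i)
    j≡1+i = trans (sym (suc-pred (toℕ j) {{>-nonZero 0<j}})) (cong suc (sym (toℕ-fromℕ< j-1<m)))

∣p∣≡∑indicator∈ : ∀ {n} (p : Subset n) → ∣ p ∣ ≡ ∑[ x < n ] indicator (x ∈? p)
∣p∣≡∑indicator∈ []            = refl
∣p∣≡∑indicator∈ (inside ∷ p)  = cong suc (∣p∣≡∑indicator∈ p)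
∣p∣≡∑indicator∈ (outside ∷ p) = ∣p∣≡∑indicator∈ p

∣S∣≡peakCount : ∀ {m} {S : Subset m} (σ : Permutation′ m) → HasCPSet σ S → ∣ S ∣ ≡ peakCount m (at σ)
∣S∣≡peakCount {m} {S} σ σ∈CP[S] = begin
  ∣ S ∣                                   ≡⟨ ∣p∣≡∑indicator∈ S ⟩
  ∑[ v < m ] indicator (v ∈? S)           ≡⟨ sum-permute _ σ ⟩
  ∑[ j < m ] indicator (σ ⟨$⟩ʳ j ∈? S)    ≡⟨ sum-cong-≗ same-indicator ⟩
  peakCount m (at σ)                      ∎
  where
  open ≡-Reasoning
  same-indicator : ∀ j → indicator (σ ⟨$⟩ʳ j ∈? S) ≡ indicator (peak? m (at σ) (toℕ j))
  same-indicator j =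
    indicator-⇔ (isCPeak⇔peak σ j ⇔-∘ σ∈CP[S] (σ ⟨$⟩ʳ j)) (σ ⟨$⟩ʳ j ∈? S) (peak? m (at σ) (toℕ j))

toℕ-punchIn-< : ∀ {n} (i : Fin (suc n)) (j : Fin n) → toℕ j < toℕ i → toℕ (punchIn i j) ≡ toℕ j
toℕ-punchIn-< (Fin.suc i) Fin.zero    _         = refl
toℕ-punchIn-< (Fin.suc i) (Fin.suc j) (s≤s j<i) = cong suc (toℕ-punchIn-< i j j<i)

toℕ-punchIn-≥ : ∀ {n} (i : Fin (suc n)) (j : Fin n) → toℕ i ≤ toℕ j → toℕ (punchIn i j) ≡ suc (toℕ j)
toℕ-punchIn-≥ Fin.zero    j           _         = refl
toℕ-punchIn-≥ (Fin.suc i) (Fin.suc j) (s≤s i≤j) = cong suc (toℕ-punchIn-≥ i j i≤j)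

insert-self : ∀ {m n} (i : Fin (suc m)) (j : Fin (suc n)) (π : Permutation m n) → insert i j π ⟨$⟩ʳ i ≡ j
insert-self i j π with i ≟ i
... | yes _  = refl
... | no i≢i = contradiction refl i≢i

module _ {n} (i : Fin (suc n)) (σ : Permutation′ n) where

  private
    τ = insert i (fromℕ n) σ

  at-insert-punchIn : ∀ j → at τ (toℕ (punchIn i j)) ≡ at σ (toℕ j)
  at-insert-punchIn j = begin
    at τ (toℕ (punchIn i j))             ≡⟨ at-toℕ τ (punchIn i j) ⟩
    toℕ (τ ⟨$⟩ʳ punchIn i j)             ≡⟨ cong toℕ (insert-punchIn i (fromℕ n) σ j) ⟩
    toℕ (punchIn (fromℕ n) (σ ⟨$⟩ʳ j))   ≡⟨ toℕ-punchIn-< (fromℕ n) (σ ⟨$⟩ʳ j)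
                                              (subst (toℕ (σ ⟨$⟩ʳ j) <_) (sym (toℕ-fromℕ n)) (toℕ<n (σ ⟨$⟩ʳ j))) ⟩
    toℕ (σ ⟨$⟩ʳ j)                       ≡⟨ at-toℕ σ j ⟨
    at σ (toℕ j)                         ∎
    where open ≡-Reasoning

  insert-isInsertion : IsInsertion (toℕ i) n (at σ) (at τ)
  insert-isInsertion = record { below = below ; inserted = inserted ; above = above }
    where
    at-τ≡at-σ : ∀ {x y} (j : Fin n) → toℕ (punchIn i j) ≡ x → toℕ j ≡ y → at τ x ≡ at σ y
    at-τ≡at-σ j refl refl = at-insert-punchIn j
    below : ∀ {x} → x < toℕ i → at τ x ≡ at σ x
    below {x} x<i = at-τ≡at-σ j (trans (toℕ-punchIn-< i j (subst (_< toℕ i) (sym j≡x) x<i)) j≡x) j≡x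
      where
      x<n = <-≤-trans x<i (s≤s⁻¹ (toℕ<n i))
      j = fromℕ< x<n
      j≡x = toℕ-fromℕ< x<n
    inserted : at τ (toℕ i) ≡ n
    inserted = trans (at-toℕ τ i) (trans (cong toℕ (insert-self i (fromℕ n) σ)) (toℕ-fromℕ n))
    above : ∀ {x} → toℕ i ≤ x → at τ (suc x) ≡ at σ x
    above {x} i≤x with n ≤? x
    ... | yes n≤x = trans (at-≥ τ (s≤s n≤x)) (sym (at-≥ σ n≤x))
    ... | no n≰x  = at-τ≡at-σ j (trans (toℕ-punchIn-≥ i j (subst (toℕ i ≤_) (sym j≡x) i≤x)) (cong suc j≡x)) j≡x
      where
      x<n = ≰⇒> n≰x
      j = fromℕ< x<n
      j≡x = toℕ-fromℕ< x<n

fromℕ∈p∷ʳinside : ∀ {n} (p : Subset n) → fromℕ n ∈ p ∷ʳ inside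
fromℕ∈p∷ʳinside []      = here
fromℕ∈p∷ʳinside (_ ∷ p) = there (fromℕ∈p∷ʳinside p)

punchIn-fromℕ∈p∷ʳ⇔ : ∀ {n} (p : Subset n) x (u : Fin n) → punchIn (fromℕ n) u ∈ p ∷ʳ x ⇔ u ∈ p
punchIn-fromℕ∈p∷ʳ⇔ (_ ∷ p) x Fin.zero    = mk⇔ (λ { here → here }) (λ { here → here })
punchIn-fromℕ∈p∷ʳ⇔ (_ ∷ p) x (Fin.suc u) =
  mk⇔ (λ { (there u∈p) → there (to u∈p) }) (λ { (there u∈p) → there (from u∈p) })
  where open Equivalence (punchIn-fromℕ∈p∷ʳ⇔ p x u)

∣p∷ʳinside∣≡1+∣p∣ : ∀ {n} (p : Subset n) → ∣ p ∷ʳ inside ∣ ≡ suc ∣ p ∣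
∣p∷ʳinside∣≡1+∣p∣ []            = refl
∣p∷ʳinside∣≡1+∣p∣ (inside ∷ p)  = cong suc (∣p∷ʳinside∣≡1+∣p∣ p)
∣p∷ʳinside∣≡1+∣p∣ (outside ∷ p) = ∣p∷ʳinside∣≡1+∣p∣ p

gap⇒cpNonEmpty-∷ʳinside : ∀ {n} {S : Subset n} (σ : Permutation′ n) → HasCPSet σ S → Gap n (at σ) →
  CPNonEmpty (suc n) (S ∷ʳ inside)
gap⇒cpNonEmpty-∷ʳinside {n} {S} σ σ∈CP[S] (h , h+1<n , ¬peak-h , ¬peak-h+1) = τ , τ∈CP[S∷ʳn]
  where
  i = fromℕ< (m<n⇒m<1+n h+1<n)
  i≡1+h : toℕ i ≡ suc h
  i≡1+h = toℕ-fromℕ< (m<n⇒m<1+n h+1<n)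
  τ = insert i (fromℕ n) σ
  open InsertMaximum (insert-isInsertion i σ) (at<m σ) (subst (_< n) (sym i≡1+h) h+1<n)

  peak-punchIn⇔ : ∀ j → Peak (suc n) (at τ) (toℕ (punchIn i j)) ⇔ Peak n (at σ) (toℕ j)
  peak-punchIn⇔ j with toℕ j <? toℕ i
  ... | yes j<i rewrite toℕ-punchIn-< i j j<i =
    peak-below⇔ (subst (λ g → ¬ Peak n (at σ) (pred g)) (sym i≡1+h) ¬peak-h) j<i
  ... | no j≮i rewrite toℕ-punchIn-≥ i j (≮⇒≥ j≮i) =
    peak-above⇔ (subst (¬_ ∘ Peak n (at σ)) (sym i≡1+h) ¬peak-h+1) (≮⇒≥ j≮i)

  isCPeak-punchIn⇔ : ∀ u → IsCPeak τ (punchIn (fromℕ n) u) ⇔ IsCPeak σ u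
  isCPeak-punchIn⇔ u = begin
    IsCPeak τ (punchIn (fromℕ n) u)          ≡⟨ cong (IsCPeak τ) τ[punchIn-i-j]≡punchIn-n-u ⟨
    IsCPeak τ (τ ⟨$⟩ʳ punchIn i j)            ≈⟨ isCPeak⇔peak τ (punchIn i j) ⟩
    Peak (suc n) (at τ) (toℕ (punchIn i j))  ≈⟨ peak-punchIn⇔ j ⟩
    Peak n (at σ) (toℕ j)                    ≈⟨ isCPeak⇔peak σ j ⟨
    IsCPeak σ (σ ⟨$⟩ʳ j)                      ≡⟨ cong (IsCPeak σ) (inverseʳ σ) ⟩
    IsCPeak σ u                              ∎
    where
    open SetoidReasoning (⇔-setoid 0ℓ)
    j = σ ⟨$⟩ˡ u
    τ[punchIn-i-j]≡punchIn-n-u = trans (insert-punchIn i (fromℕ n) σ j) (cong (punchIn (fromℕ n)) (inverseʳ σ))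

  τ∈CP[S∷ʳn] : HasCPSet τ (S ∷ʳ inside)
  τ∈CP[S∷ʳn] v with v ≟ fromℕ n
  ... | yes refl = mk⇔
    (λ _ → subst (IsCPeak τ) (insert-self i (fromℕ n) σ)
                 (Equivalence.from (isCPeak⇔peak τ i) (peak-inserted (subst (0 <_) (sym i≡1+h) z<s))))
    (λ _ → fromℕ∈p∷ʳinside S)
  ... | no v≢n = subst (λ w → w ∈ S ∷ʳ inside ⇔ IsCPeak τ w) (punchIn-punchOut (v≢n ∘ sym))
    (⇔-sym (isCPeak-punchIn⇔ u) ⇔-∘ (σ∈CP[S] u ⇔-∘ punchIn-fromℕ∈p∷ʳ⇔ S inside u))
    where
    u = punchOut (v≢n ∘ sym)

cpNonEmpty⇒2*∣S∣<n : ∀ {y} {S : Subset (suc y)} → CPNonEmpty (suc y) S → 2 * ∣ S ∣ < suc y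
cpNonEmpty⇒2*∣S∣<n {y} (σ , σ∈CP[S]) =
  subst (λ c → 2 * c < suc y) (sym (∣S∣≡peakCount σ σ∈CP[S])) (peakCount-bound y (at σ))

cpNonEmpty-∷ʳinside : ∀ {n} {S : Subset n} → CPNonEmpty n S → 2 * suc ∣ S ∣ ≤ n → CPNonEmpty (suc n) (S ∷ʳ inside)
cpNonEmpty-∷ʳinside {n} (σ , σ∈CP[S]) few-peaks = gap⇒cpNonEmpty-∷ʳinside σ σ∈CP[S]
  (2*[1+peakCount]≤m⇒gap n (at σ) (subst (λ c → 2 * suc c ≤ n) (∣S∣≡peakCount σ σ∈CP[S]) few-peaks))

parity : ∀ p → (p ≡ p / 2 * 2 × suc p % 2 ≡ 1) ⊎ (p ≡ 1 + p / 2 * 2 × suc p % 2 ≡ 0)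
parity p with p % 2 | m%n<n p 2 | m≡m%n+[m/n]*n p 2
... | 0           | _            | p≡k*2   =
  inj₁ (p≡k*2 , trans (cong (λ x → suc x % 2) p≡k*2) ([m+kn]%n≡m%n 1 (p / 2) 2))
... | 1           | _            | p≡1+k*2 =
  inj₂ (p≡1+k*2 , trans (cong (λ x → suc x % 2) p≡1+k*2) ([m+kn]%n≡m%n 2 (p / 2) 2))
... | suc (suc _) | s≤s (s≤s ()) | _

-- The hypothesis 3 ≤ n is only used to exclude n = 0.
corollary2p2 : (n : ℕ) → 3 ≤ n → (S : Subset n) → CPNonEmpty n S →
    (∣ S ∣ < (n ∸ 1) / 2 → CPNonEmpty (suc n) (S ∷ʳ inside)) ×
    (∣ S ∣ ≡ (n ∸ 1) / 2 →
      (n % 2 ≡ 0 → CPNonEmpty (suc n) (S ∷ʳ inside)) ×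
      (n % 2 ≡ 1 → ¬ CPNonEmpty (suc n) (S ∷ʳ inside)))
corollary2p2 (suc p) _ S cp[S] = extend-small , λ ∣S∣≡k → extend-even ∣S∣≡k , ¬extend-odd ∣S∣≡k
  where
  open ≡-Reasoning
  k = p / 2
  2[1+∣S∣]≡2+k*2 : ∣ S ∣ ≡ k → 2 * suc ∣ S ∣ ≡ 2 + k * 2
  2[1+∣S∣]≡2+k*2 ∣S∣≡k = trans (cong (λ c → 2 * suc c) ∣S∣≡k) (trans (*-suc 2 k) (cong (2 +_) (*-comm 2 k)))
  extend-small : ∣ S ∣ < k → CPNonEmpty (suc (suc p)) (S ∷ʳ inside)
  extend-small ∣S∣<k = cpNonEmpty-∷ʳinside cp[S]
    (m≤n⇒m≤1+n (≤-trans (*-monoʳ-≤ 2 ∣S∣<k) (subst (_≤ p) (*-comm k 2) (m/n*n≤m p 2))))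
  extend-even : ∣ S ∣ ≡ k → suc p % 2 ≡ 0 → CPNonEmpty (suc (suc p)) (S ∷ʳ inside)
  extend-even ∣S∣≡k [1+p]%2≡0 with parity p
  ... | inj₁ (_ , [1+p]%2≡1) = contradiction (trans (sym [1+p]%2≡0) [1+p]%2≡1) λ ()
  ... | inj₂ (p≡1+k*2 , _)   = cpNonEmpty-∷ʳinside cp[S] (≤-reflexive (begin
    2 * suc ∣ S ∣  ≡⟨ 2[1+∣S∣]≡2+k*2 ∣S∣≡k ⟩
    2 + k * 2      ≡⟨ cong suc p≡1+k*2 ⟨
    suc p          ∎))
  ¬extend-odd : ∣ S ∣ ≡ k → suc p % 2 ≡ 1 → ¬ CPNonEmpty (suc (suc p)) (S ∷ʳ inside)
  ¬extend-odd ∣S∣≡k [1+p]%2≡1 cp[S∷ʳn] with parity p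
  ... | inj₂ (_ , [1+p]%2≡0) = contradiction (trans (sym [1+p]%2≡0) [1+p]%2≡1) λ ()
  ... | inj₁ (p≡k*2 , _)     = <-irrefl (begin
    2 * ∣ S ∷ʳ inside ∣  ≡⟨ cong (2 *_) (∣p∷ʳinside∣≡1+∣p∣ S) ⟩
    2 * suc ∣ S ∣        ≡⟨ 2[1+∣S∣]≡2+k*2 ∣S∣≡k ⟩
    2 + k * 2            ≡⟨ cong (2 +_) p≡k*2 ⟨
    suc (suc p)          ∎) (cpNonEmpty⇒2*∣S∣<n cp[S∷ʳn])
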